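{- For positive integers $m,n$, let $N=R(m,n)+m+n-2$. There exists a red/blue coloring of the edges of the complete graph on vertex set $[N]=\{1,\dots,N\}$ that contains no red ordered copy of $K_m^1$ and no blue ordered copy of $K_n^1$.
   Context: For an integer $k\ge1$, $K_k^1$ denotes the ordered graph on vertex set $\{1,\dots,k+1\}$ (with the natural order) whose edges are all pairs $\{i,j\}$ with $2\le i<j\le k+1$ together with the edge $\{1,2\}$ (a complete graph on $\{2,\dots,k+1\}$ with a pendant edge from vertex $1$ to vertex $2$). Given a red/blue coloring of the edges of the complete graph on $[N]$, a red (resp. blue) ordered copy of an ordered graph $H$ on $[k]$ is a strictly increasing map $\phi:[k]\to[N]$ such that every edge $\{\phi(i),\phi(j)\}$ with $\{i,j\}\in E(H)$ is red (resp. blue). $R(m,n)$ is the classical Ramsey number: the least $N$ such that every red/blue coloring of the edges of $K_N$ contains a red $K_m$ or a blue $K_n$. -}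

module Defs where

open import Data.Nat using (ℕ; zero; suc; _+_; _∸_)
open import Data.Fin using (Fin; toℕ; _<_)
open import Data.Product using (Σ; _×_)
open import Data.Sum using (_⊎_)
open import Relation.Nullary using (¬_)
open import Relation.Binary.PropositionalEquality using (_≡_)

data Colour : Set where
  red blue : Colour

-- A red/blue colouring of the edges of the complete graph on N vertices
-- (vertices Fin N, i.e. 0,...,N-1 with the natural order, standing for 1,...,N).
-- The colour of the edge {a,b} with a < b is  c a b ; values c a b with
-- a ≥ b are irrelevant (never consulted).
Colouring : ℕ → Set
Colouring N = Fin N → Fin N → Colour

-- An ordered graph on k vertices: an edge relation on Fin k; the edge {i,j}
-- with i < j is present iff  E i j  (only pairs i < j are consulted).
OrderedGraph : ℕ → Set₁
OrderedGraph k = Fin k → Fin k → Set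

StrictlyIncreasing : ∀ {k N} → (Fin k → Fin N) → Set
StrictlyIncreasing φ = ∀ i j → i < j → φ i < φ j

HasOrderedCopy : ∀ {N k} → Colouring N → Colour → OrderedGraph k → Set
HasOrderedCopy {N} {k} c col H =
  Σ (Fin k → Fin N) λ φ →
    StrictlyIncreasing φ × (∀ i j → i < j → H i j → c (φ i) (φ j) ≡ col)

Complete : (k : ℕ) → OrderedGraph k
Complete k i j = i < j

-- K_k^1 on k+1 vertices 0..k (paper: 1..k+1): complete graph on {1,...,k}
-- (paper: {2,...,k+1}) together with the pendant edge {0,1} (paper: {1,2}).
K1 : (k : ℕ) → OrderedGraph (suc k)
K1 k i j = (1 Data.Nat.≤ toℕ i) ⊎ (toℕ i ≡ 0 × toℕ j ≡ 1)

-- Ramsey property: every colouring of K_N has a red K_m or a blue K_n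
-- (a red/blue clique = an ordered copy of the complete graph, equivalently
-- an unordered clique).
RamseyProperty : ℕ → ℕ → ℕ → Set
RamseyProperty m n N =
  (c : Colouring N) → HasOrderedCopy c red (Complete m) ⊎ HasOrderedCopy c blue (Complete n)

IsRamseyNumber : ℕ → ℕ → ℕ → Set
IsRamseyNumber m n r = RamseyProperty m n r × (∀ N → RamseyProperty m n N → r Data.Nat.≤ N)

-- Take a colouring of K_(R(m,n)-1) with no red K_m and no blue K_n, and put in front of it a
-- prefix 0, 1, …, m+n-2: the vertices below m span a red clique, the vertices m, …, m+n-2 are
-- joined in blue to everything before them, and a prefix vertex u is joined to the old
-- vertices in blue if 1 ≤ u < m and in red otherwise.  In a red K_m^1 (resp. blue K_n^1) the
-- second vertex cannot lie among the old vertices, since the clique after it would then be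
-- monochromatic there; so it lies in the prefix, where the pendant edge forces it below m
-- (resp. to at least m), and its edge to the last vertex of the copy has the wrong colour.
module Submission where

open import Defs
open import Data.Nat using (ℕ; _+_; _∸_; _≤_)
open import Data.Product using (Σ; _×_)
open import Relation.Nullary using (¬_)

open import Data.Nat using (zero; suc; _<_; z≤n; s≤s; s≤s⁻¹; z<s; _≤?_)
open import Data.Nat.Properties
open import Data.Fin as Fin using (Fin; zero; suc; toℕ; fromℕ; reduce≥)
import Data.Fin.Properties as Fin
open import Data.Vec using (Vec; []; _∷_; lookup; tabulate)
open import Data.Vec.Properties using (lookup∘tabulate)
open import Data.Product using (∃; _,_; proj₁; proj₂)
open import Data.Sum using (inj₁; inj₂)
open import Function using (_∘_)
open import Relation.Unary using (Decidable)
open import Relation.Nullary using (Dec; yes; no; contradiction)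
open import Relation.Nullary.Decidable using (map′; ¬?; _×-dec_; _⊎-dec_; _→-dec_; decidable-stable)
open import Relation.Binary.PropositionalEquality

Exhaustible : Set → Set₁
Exhaustible A = {P : A → Set} → Decidable P → Dec (∃ P)

Colour-exhaustible : Exhaustible Colour
Colour-exhaustible P? =
  map′ (λ { (inj₁ p) → red , p ; (inj₂ p) → blue , p }) (λ { (red , p) → inj₁ p ; (blue , p) → inj₂ p })
       (P? red ⊎-dec P? blue)

Vec-exhaustible : ∀ {A} → Exhaustible A → ∀ k → Exhaustible (Vec A k)
Vec-exhaustible ∃A? zero    P? = map′ ([] ,_) (λ { ([] , p) → p }) (P? [])
Vec-exhaustible ∃A? (suc k) P? =
  map′ (λ (a , v , p) → a ∷ v , p) (λ { (a ∷ v , p) → a , v , p })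
       (∃A? (λ a → Vec-exhaustible ∃A? k (P? ∘ (a ∷_))))

-- Without function extensionality, functions on Fin k can only be searched for properties
-- invariant under pointwise equality; they are searched through their tables.
→-exhaustible : ∀ {A} → Exhaustible A → ∀ k {P : (Fin k → A) → Set} →
                (∀ {f g} → f ≗ g → P f → P g) → Decidable P → Dec (∃ P)
→-exhaustible ∃A? k resp P? =
  map′ (λ (v , p) → lookup v , p) (λ (f , p) → tabulate f , resp (sym ∘ lookup∘tabulate f) p)
       (Vec-exhaustible ∃A? k (P? ∘ lookup))

Colouring-exhaustible : ∀ N {P : Colouring N → Set} →
                        (∀ {c d} → (∀ a b → c a b ≡ d a b) → P c → P d) → Decidable P → Dec (∃ P)
Colouring-exhaustible N resp P? =
  map′ (λ (w , p) → (λ a → lookup (w a)) , p)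
       (λ (c , p) → (λ a → tabulate (c a)) , resp (λ a b → sym (lookup∘tabulate (c a) b)) p)
       (→-exhaustible (Vec-exhaustible Colour-exhaustible N) N
          (λ w≗ → resp (λ a b → cong (λ v → lookup v b) (w≗ a)))
          (λ w → P? (λ a → lookup (w a))))

_≟ᶜ_ : (a b : Colour) → Dec (a ≡ b)
red  ≟ᶜ red  = yes refl
red  ≟ᶜ blue = no λ ()
blue ≟ᶜ red  = no λ ()
blue ≟ᶜ blue = yes refl

red≢blue : red ≢ blue
red≢blue ()

copy-resp : ∀ {N k col} {H : OrderedGraph k} {c d : Colouring N} →
            (∀ a b → c a b ≡ d a b) → HasOrderedCopy c col H → HasOrderedCopy d col H
copy-resp c≗d (φ , φ↑ , e) = φ , φ↑ , λ i j i<j h → trans (sym (c≗d (φ i) (φ j))) (e i j i<j h)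

copy? : ∀ {N k} (c : Colouring N) col {H : OrderedGraph k} →
        (∀ i j → Dec (H i j)) → Dec (HasOrderedCopy c col H)
copy? {N} {k} c col {H} H? = →-exhaustible (Fin.any? {N}) k isCopy-resp isCopy?
  where
    IsCopy : (Fin k → Fin N) → Set
    IsCopy φ = StrictlyIncreasing φ × (∀ i j → i Fin.< j → H i j → c (φ i) (φ j) ≡ col)

    isCopy-resp : ∀ {φ ψ} → φ ≗ ψ → IsCopy φ → IsCopy ψ
    isCopy-resp φ≗ψ (φ↑ , e) =
      (λ i j i<j → subst₂ Fin._<_ (φ≗ψ i) (φ≗ψ j) (φ↑ i j i<j)) ,
      (λ i j i<j h → subst₂ (λ x y → c x y ≡ col) (φ≗ψ i) (φ≗ψ j) (e i j i<j h))

    isCopy? : Decidable IsCopy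
    isCopy? φ =
      Fin.all? (λ i → Fin.all? λ j → (i Fin.<? j) →-dec (φ i Fin.<? φ j)) ×-dec
      Fin.all? (λ i → Fin.all? λ j → (i Fin.<? j) →-dec (H? i j →-dec (c (φ i) (φ j) ≟ᶜ col)))

Avoids : ∀ {N k l} → Colouring N → OrderedGraph k → OrderedGraph l → Set
Avoids c H G = ¬ HasOrderedCopy c red H × ¬ HasOrderedCopy c blue G

complete? : ∀ {k} (i j : Fin k) → Dec (Complete k i j)
complete? = Fin._<?_

ramsey-if-none-avoids : ∀ {m n N} →
                        ¬ (∃ λ (c : Colouring N) → Avoids c (Complete m) (Complete n)) →
                        RamseyProperty m n N
ramsey-if-none-avoids none c with copy? c red complete? | copy? c blue complete?
... | yes K  | _      = inj₁ K
... | no _   | yes K  = inj₂ K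
... | no ¬R  | no ¬B  = contradiction (c , ¬R , ¬B) none

-- A classical step made constructive: colourings of K_N can be searched exhaustively.
avoiding-colouring : ∀ {m n N} → ¬ RamseyProperty m n N →
                     ∃ λ (c : Colouring N) → Avoids c (Complete m) (Complete n)
avoiding-colouring {m} {n} {N} ¬ramsey =
  decidable-stable (Colouring-exhaustible N avoids-resp avoids?) (¬ramsey ∘ ramsey-if-none-avoids)
  where
    avoids-resp : ∀ {c d : Colouring N} → (∀ a b → c a b ≡ d a b) →
           Avoids c (Complete m) (Complete n) → Avoids d (Complete m) (Complete n)
    avoids-resp c≗d (¬R , ¬B) = ¬R ∘ copy-resp (λ a b → sym (c≗d a b)) , ¬B ∘ copy-resp (λ a b → sym (c≗d a b))

    avoids? : Decidable (λ (c : Colouring N) → Avoids c (Complete m) (Complete n))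
    avoids? c = ¬? (copy? c red complete?) ×-dec ¬? (copy? c blue complete?)

avoiding-below-Ramsey : ∀ {m n r} → IsRamseyNumber m n (suc r) →
                        ∃ λ (c : Colouring r) → Avoids c (Complete m) (Complete n)
avoiding-below-Ramsey (_ , least) = avoiding-colouring λ ramsey → <-irrefl refl (least _ ramsey)

¬RamseyProperty-0 : ∀ {m n} → ¬ RamseyProperty (suc m) (suc n) 0
¬RamseyProperty-0 ramsey with ramsey (λ ())
... | inj₁ (φ , _) = Fin.¬Fin0 (φ zero)
... | inj₂ (φ , _) = Fin.¬Fin0 (φ zero)

strictlyIncreasing-suc : ∀ {k N} {φ : Fin (suc k) → Fin N} → StrictlyIncreasing φ →
                         StrictlyIncreasing (φ ∘ suc)
strictlyIncreasing-suc φ↑ i j = φ↑ (suc i) (suc j) ∘ s≤s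

strictlyIncreasing-first≤ : ∀ {k N} (φ : Fin (suc k) → Fin N) → StrictlyIncreasing φ →
                            ∀ i → toℕ (φ zero) ≤ toℕ (φ i)
strictlyIncreasing-first≤ φ φ↑ zero    = ≤-refl
strictlyIncreasing-first≤ φ φ↑ (suc i) = <⇒≤ (φ↑ zero (suc i) z<s)

strictlyIncreasing-first+k≤last : ∀ {k N} (φ : Fin (suc k) → Fin N) → StrictlyIncreasing φ →
                                  toℕ (φ zero) + k ≤ toℕ (φ (fromℕ k))
strictlyIncreasing-first+k≤last {zero}  φ φ↑ = ≤-reflexive (+-identityʳ _)
strictlyIncreasing-first+k≤last {suc k} φ φ↑ = begin
  toℕ (φ zero) + suc k      ≡⟨ +-suc (toℕ (φ zero)) k ⟩
  suc (toℕ (φ zero)) + k    ≤⟨ +-monoˡ-≤ k (φ↑ zero (suc zero) z<s) ⟩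
  toℕ (φ (suc zero)) + k    ≤⟨ strictlyIncreasing-first+k≤last (φ ∘ suc) (strictlyIncreasing-suc φ↑) ⟩
  toℕ (φ (fromℕ (suc k)))   ∎
  where open ≤-Reasoning

toℕ-reduce≥ : ∀ {m n} (i : Fin (m + n)) .(m≤i : m ≤ toℕ i) → toℕ (reduce≥ i m≤i) ≡ toℕ i ∸ m
toℕ-reduce≥ {zero}  i       _   = refl
toℕ-reduce≥ {suc m} (suc i) m≤i = toℕ-reduce≥ {m} i (s≤s⁻¹ m≤i)

1<toℕ-fromℕ : ∀ {k} → 1 < k → 1 < toℕ (fromℕ k)
1<toℕ-fromℕ {k} 1<k = subst (1 <_) (sym (Fin.toℕ-fromℕ k)) 1<k

module K1Avoiding (m′ n′ : ℕ) {r : ℕ} (base : Colouring r)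
                  (base-avoids : Avoids base (Complete (suc m′)) (Complete (suc n′))) where

  m n prefix : ℕ
  m = suc m′
  n = suc n′
  prefix = m + n′

  data Region (x : Fin (prefix + r)) : Set where
    apex : toℕ x ≡ 0 → Region x
    low  : 1 ≤ toℕ x → toℕ x < m → Region x
    high : m ≤ toℕ x → toℕ x < prefix → Region x
    tail : prefix ≤ toℕ x → Region x

  region : ∀ x → Region x
  region x with prefix ≤? toℕ x | m ≤? toℕ x | toℕ x ≟ 0
  ... | yes p≤x | _       | _     = tail p≤x
  ... | no x≱p  | yes m≤x | _     = high m≤x (≰⇒> x≱p)
  ... | no _    | no x≱m  | yes x≡0 = apex x≡0
  ... | no _    | no x≱m  | no x≢0  = low (n≢0⇒n>0 x≢0) (≰⇒> x≱m)

  regionColour : ∀ {x y} → Region x → Region y → Colour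
  regionColour _          (apex _)   = red
  regionColour _          (low _ _)  = red
  regionColour _          (high _ _) = blue
  regionColour (apex _)   (tail _)   = red
  regionColour (low _ _)  (tail _)   = blue
  regionColour (high _ _) (tail _)   = red
  regionColour {x} {y} (tail p) (tail q) = base (reduce≥ x p) (reduce≥ y q)

  colouring : Colouring (prefix + r)
  colouring x y = regionColour (region x) (region y)

  m≤prefix : m ≤ prefix
  m≤prefix = m≤m+n m n′

  colour-into-low : ∀ {x y} → toℕ y < m → colouring x y ≡ red
  colour-into-low {y = y} y<m with region y
  ... | apex _     = refl
  ... | low _ _    = refl
  ... | high m≤y _ = contradiction y<m (≤⇒≯ m≤y)
  ... | tail p≤y   = contradiction y<m (≤⇒≯ (≤-trans m≤prefix p≤y))

  colour-into-high : ∀ {x y} → m ≤ toℕ y → toℕ y < prefix → colouring x y ≡ blue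
  colour-into-high {y = y} m≤y y<p with region y
  ... | apex y≡0   = contradiction (subst (m ≤_) y≡0 m≤y) λ ()
  ... | low _ y<m  = contradiction y<m (≤⇒≯ m≤y)
  ... | high _ _   = refl
  ... | tail p≤y   = contradiction y<p (≤⇒≯ p≤y)

  colour-low-to-upper : ∀ {x y} → 1 ≤ toℕ x → toℕ x < m → m ≤ toℕ y → colouring x y ≡ blue
  colour-low-to-upper {x} {y} 1≤x x<m m≤y with region x | region y
  ... | _          | apex y≡0  = contradiction (subst (m ≤_) y≡0 m≤y) λ ()
  ... | _          | low _ y<m = contradiction y<m (≤⇒≯ m≤y)
  ... | _          | high _ _  = refl
  ... | apex x≡0   | tail _    = contradiction (subst (1 ≤_) x≡0 1≤x) λ ()
  ... | low _ _    | tail _    = refl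
  ... | high m≤x _ | tail _    = contradiction x<m (≤⇒≯ m≤x)
  ... | tail p≤x   | tail _    = contradiction x<m (≤⇒≯ (≤-trans m≤prefix p≤x))

  colour-high-to-tail : ∀ {x y} → m ≤ toℕ x → toℕ x < prefix → prefix ≤ toℕ y → colouring x y ≡ red
  colour-high-to-tail {x} {y} m≤x x<p p≤y with region x | region y
  ... | _         | apex y≡0   = refl
  ... | _         | low _ _    = refl
  ... | _         | high _ y<p = contradiction y<p (≤⇒≯ p≤y)
  ... | apex x≡0  | tail _     = refl
  ... | low _ x<m | tail _     = contradiction x<m (≤⇒≯ m≤x)
  ... | high _ _  | tail _     = refl
  ... | tail p≤x  | tail _     = contradiction x<p (≤⇒≯ p≤x)

  colour-tail : ∀ {x y} (p≤x : prefix ≤ toℕ x) (p≤y : prefix ≤ toℕ y) →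
                colouring x y ≡ base (reduce≥ x p≤x) (reduce≥ y p≤y)
  colour-tail {x} {y} p≤x p≤y with region x | region y
  ... | tail _     | tail _     = refl
  ... | apex x≡0   | _          = contradiction (subst (prefix ≤_) x≡0 p≤x) λ ()
  ... | low _ x<m  | _          = contradiction x<m (≤⇒≯ (≤-trans m≤prefix p≤x))
  ... | high _ x<p | _          = contradiction x<p (≤⇒≯ p≤x)
  ... | tail _     | apex y≡0   = contradiction (subst (prefix ≤_) y≡0 p≤y) λ ()
  ... | tail _     | low _ y<m  = contradiction y<m (≤⇒≯ (≤-trans m≤prefix p≤y))
  ... | tail _     | high _ y<p = contradiction y<p (≤⇒≯ p≤y)

  tail-copy : ∀ {k col} (φ : Fin k → Fin (prefix + r)) → StrictlyIncreasing φ →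
              (inTail : ∀ a → prefix ≤ toℕ (φ a)) →
              (∀ a b → a Fin.< b → colouring (φ a) (φ b) ≡ col) →
              HasOrderedCopy base col (Complete k)
  tail-copy {k} φ φ↑ inTail e = ψ , ψ↑ , λ a b a<b _ → trans (sym (colour-tail (inTail a) (inTail b))) (e a b a<b)
    where
      ψ : Fin k → Fin r
      ψ a = reduce≥ (φ a) (inTail a)

      ψ↑ : StrictlyIncreasing ψ
      ψ↑ a b a<b = subst₂ _<_ (sym (toℕ-reduce≥ (φ a) (inTail a))) (sym (toℕ-reduce≥ (φ b) (inTail b)))
                          (∸-monoˡ-< (φ↑ a b a<b) (inTail a))

  K1-tail-copy : ∀ {k col} (copy : HasOrderedCopy colouring col (K1 (suc k))) →
                 prefix ≤ toℕ (proj₁ copy (suc zero)) → HasOrderedCopy base col (Complete (suc k))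
  K1-tail-copy (φ , φ↑ , e) p≤φ₁ =
    tail-copy (φ ∘ suc) (strictlyIncreasing-suc φ↑)
      (λ a → ≤-trans p≤φ₁ (strictlyIncreasing-first≤ (φ ∘ suc) (strictlyIncreasing-suc φ↑) a))
      (λ a b a<b → e (suc a) (suc b) (s≤s a<b) (inj₁ (s≤s z≤n)))

  no-red-K1 : ¬ HasOrderedCopy colouring red (K1 m)
  no-red-K1 copy@(φ , φ↑ , e) with prefix ≤? toℕ (φ (suc zero)) | m ≤? toℕ (φ (suc zero))
  ... | yes p≤φ₁ | _       = proj₁ base-avoids (K1-tail-copy copy p≤φ₁)
  ... | no φ₁≱p  | yes m≤φ₁ =
    red≢blue (trans (sym (e zero (suc zero) z<s (inj₂ (refl , refl)))) (colour-into-high m≤φ₁ (≰⇒> φ₁≱p)))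
  ... | no _     | no φ₁≱m =
    red≢blue (trans (sym (e (suc zero) (fromℕ m) (1<toℕ-fromℕ (≤-<-trans 1≤φ₁ φ₁<m)) (inj₁ ≤-refl)))
                    (colour-low-to-upper 1≤φ₁ φ₁<m m≤φₘ))
    where
      φ₁<m : toℕ (φ (suc zero)) < m
      φ₁<m = ≰⇒> φ₁≱m
      1≤φ₁ : 1 ≤ toℕ (φ (suc zero))
      1≤φ₁ = ≤-trans (s≤s z≤n) (φ↑ zero (suc zero) z<s)
      m≤φₘ : m ≤ toℕ (φ (fromℕ m))
      m≤φₘ = ≤-trans (m≤n+m m _) (strictlyIncreasing-first+k≤last φ φ↑)

  no-blue-K1 : ¬ HasOrderedCopy colouring blue (K1 n)
  no-blue-K1 copy@(φ , φ↑ , e) with prefix ≤? toℕ (φ (suc zero)) | m ≤? toℕ (φ (suc zero))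
  ... | yes p≤φ₁ | _       = proj₂ base-avoids (K1-tail-copy copy p≤φ₁)
  ... | no _     | no φ₁≱m =
    red≢blue (trans (sym (colour-into-low (≰⇒> φ₁≱m))) (e zero (suc zero) z<s (inj₂ (refl , refl))))
  ... | no φ₁≱p  | yes m≤φ₁ =
    red≢blue (trans (sym (colour-high-to-tail m≤φ₁ φ₁<p p≤φₙ))
                    (e (suc zero) (fromℕ n) (1<toℕ-fromℕ (s≤s 0<n′)) (inj₁ ≤-refl)))
    where
      φ₁<p : toℕ (φ (suc zero)) < prefix
      φ₁<p = ≰⇒> φ₁≱p
      0<n′ : 0 < n′
      0<n′ = +-cancelˡ-< m 0 n′ (subst (_< prefix) (sym (+-identityʳ m)) (≤-<-trans m≤φ₁ φ₁<p))
      p≤φₙ : prefix ≤ toℕ (φ (fromℕ n))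
      p≤φₙ = ≤-trans (+-monoˡ-≤ n′ m≤φ₁)
                     (strictlyIncreasing-first+k≤last (φ ∘ suc) (strictlyIncreasing-suc φ↑))

vertex-count : ∀ r m n → suc r + suc m + suc n ∸ 2 ≡ suc m + n + r
vertex-count r m n = begin
  suc r + suc m + suc n ∸ 2   ≡⟨ cong (_∸ 1) (+-suc (r + suc m) n) ⟩
  r + suc m + n               ≡⟨ +-assoc r (suc m) n ⟩
  r + (suc m + n)             ≡⟨ +-comm r (suc m + n) ⟩
  suc m + n + r               ∎
  where open ≡-Reasoning

proposition5p3 : (m n r : ℕ) → 1 ≤ m → 1 ≤ n → IsRamseyNumber m n r →
    Σ (Colouring (r + m + n ∸ 2)) λ c →
      ¬ HasOrderedCopy c red (K1 m) × ¬ HasOrderedCopy c blue (K1 n)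
proposition5p3 zero     _        _       ()  _   _
proposition5p3 (suc _)  zero     _       _   ()  _
proposition5p3 (suc m′) (suc n′) zero    _   _   (ramsey , _) = contradiction ramsey ¬RamseyProperty-0
proposition5p3 (suc m′) (suc n′) (suc r) _   _   isRamsey =
  subst (λ N → ∃ λ (c : Colouring N) → Avoids c (K1 (suc m′)) (K1 (suc n′)))
        (sym (vertex-count r m′ n′))
        (colouring , no-red-K1 , no-blue-K1)
  where
    open K1Avoiding m′ n′ (proj₁ (avoiding-below-Ramsey isRamsey)) (proj₂ (avoiding-below-Ramsey isRamsey))
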